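{- For all PCoR* terms $t, s$ over $\Sigma$: $\mathsf{REL} \models t \le s$ if and only if $\mathsf{REL}_{\mathrm{tw} \le 2} \models t \le s$.
   Context: PCoR* terms over $\Sigma$: $t ::= a \mid 1 \mid 0 \mid \top \mid t;t \mid t+t \mid t\cap t \mid t^{\smile} \mid t^{*}$, $a\in\Sigma$. A structure $S$ is a non-empty set $|S|$ with $a^S\subseteq|S|^2$ for each $a\in\Sigma$; semantics $[\![a]\!]_S=a^S$, $[\![1]\!]_S$ = identity on $|S|$, $[\![0]\!]_S=\emptyset$, $[\![\top]\!]_S=|S|^2$, and $;,+,\cap,{}^{\smile},{}^{*}$ are relational composition, union, intersection, converse, reflexive-transitive closure. $\mathsf{REL}$ = class of all structures; $\mathcal C\models t\le s$ means $[\![t]\!]_S\subseteq[\![s]\!]_S$ for all $S\in\mathcal C$. $\mathsf{REL}_{\mathrm{tw}\le 2}$ is the class of (finite) structures of treewidth at most $2$, where the treewidth of $S$ is that of the undirected simple graph on $|S|$ with an edge between distinct $x,y$ whenever $(x,y)\in a^S$ for some $a\in\Sigma$. -}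

module Defs where

open import Data.Nat using (ℕ; zero; suc; _≤_)
open import Data.Fin using (Fin; toℕ) renaming (zero to fzero; suc to fsuc)
open import Data.List using (List; length)
open import Data.List.Membership.Propositional using (_∈_)
open import Data.Product using (Σ; ∃; _×_; _,_)
open import Data.Sum using (_⊎_)
open import Data.Empty using (⊥)
open import Data.Unit using (⊤)
open import Relation.Binary.PropositionalEquality using (_≡_; _≢_)
open import Relation.Binary.Construct.Closure.ReflexiveTransitive using (Star)

infixl 6 _∪_
infixl 7 _∩_
infixl 8 _⨾_
infix 9 _˘ _⋆

data Term (A : Set) : Set where
  var  : A → Term A
  𝟏    : Term A
  𝟎    : Term A
  ⊤ₜ   : Term A
  _⨾_  : Term A → Term A → Term A
  _∪_  : Term A → Term A → Term A
  _∩_  : Term A → Term A → Term A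
  _˘   : Term A → Term A
  _⋆   : Term A → Term A

record Structure (A : Set) : Set₁ where
  field
    Carrier : Set
    point   : Carrier                      -- non-emptiness
    rel     : A → Carrier → Carrier → Set

open Structure public

⟦_⟧ : {A : Set} → Term A → (S : Structure A) → Carrier S → Carrier S → Set
⟦ var a ⟧ S x y = rel S a x y
⟦ 𝟏 ⟧     S x y = x ≡ y
⟦ 𝟎 ⟧     S x y = ⊥
⟦ ⊤ₜ ⟧    S x y = ⊤
⟦ t ⨾ u ⟧ S x y = ∃ λ z → ⟦ t ⟧ S x z × ⟦ u ⟧ S z y
⟦ t ∪ u ⟧ S x y = ⟦ t ⟧ S x y ⊎ ⟦ u ⟧ S x y
⟦ t ∩ u ⟧ S x y = ⟦ t ⟧ S x y × ⟦ u ⟧ S x y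
⟦ t ˘ ⟧   S x y = ⟦ t ⟧ S y x
⟦ t ⋆ ⟧   S x y = Star (⟦ t ⟧ S) x y

_⊨_≤_ : {A : Set} → Structure A → Term A → Term A → Set
S ⊨ t ≤ s = ∀ x y → ⟦ t ⟧ S x y → ⟦ s ⟧ S x y

REL⊨_≤_ : {A : Set} → Term A → Term A → Set₁
REL⊨_≤_ {A} t s = (S : Structure A) → S ⊨ t ≤ s

-- A finite tree on nodes Fin (suc k): node 0 is the root and node (fsuc l)
-- has parent (parent l), whose index is ≤ l (hence < index of fsuc l).
-- Undirected tree edges:
TreeEdge : {k : ℕ} → (Fin k → Fin (suc k)) → Fin (suc k) → Fin (suc k) → Set
TreeEdge {k} parent i j =
  ∃ λ (l : Fin k) → (i ≡ fsuc l × j ≡ parent l) ⊎ (j ≡ fsuc l × i ≡ parent l)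

TreeEdgeAt : {n k : ℕ} → (Fin k → Fin (suc k)) → (Fin (suc k) → List (Fin n)) →
             Fin n → Fin (suc k) → Fin (suc k) → Set
TreeEdgeAt parent bag x i j = TreeEdge parent i j × x ∈ bag i × x ∈ bag j

record TreeDecompW2 {n : ℕ} (E : Fin n → Fin n → Set) : Set where
  field
    k         : ℕ
    parent    : Fin k → Fin (suc k)
    parent-<  : ∀ l → toℕ (parent l) ≤ toℕ l
    bag       : Fin (suc k) → List (Fin n)
    width≤2   : ∀ i → length (bag i) ≤ 3
    vcover    : ∀ x → ∃ λ i → x ∈ bag i
    ecover    : ∀ x y → x ≢ y → E x y → ∃ λ i → x ∈ bag i × y ∈ bag i
    connected : ∀ x i j → x ∈ bag i → x ∈ bag j → Star (TreeEdgeAt parent bag x) i j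

-- Gaifman graph of the structure's relations (orientation irrelevant
-- since edge coverage is symmetric in x and y)
GraphEdge : {A : Set} {n : ℕ} → (A → Fin n → Fin n → Set) → Fin n → Fin n → Set
GraphEdge {A} r x y = Σ A λ a → r a x y

-- Finite structure with carrier Fin (suc n) (every finite non-empty
-- structure is isomorphic to one of these)
finStructure : {A : Set} (n : ℕ) → (A → Fin (suc n) → Fin (suc n) → Set) → Structure A
finStructure n r = record { Carrier = Fin (suc n) ; point = fzero ; rel = r }

TW2⊨_≤_ : {A : Set} → Term A → Term A → Set₁
TW2⊨_≤_ {A} t s =
  (n : ℕ) (r : A → Fin (suc n) → Fin (suc n) → Set) →
  TreeDecompW2 (GraphEdge r) → finStructure n r ⊨ t ≤ s

{-# OPTIONS --safe #-}
module Submission where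

-- Only REL_{tw≤2} ⊨ t ≤ s ⇒ REL ⊨ t ≤ s needs an argument.  A witness of
-- (x , y) ∈ ⟦ t ⟧ S is unfolded into a finite structure whose vertices are
-- the nodes of a width-2 tree decomposition, each labelled by the point of S
-- it stands for, so that labelling is a homomorphism into S and t holds
-- between vertices labelled x and y.  The unfolding follows the witness: a
-- composition t ⨾ u gets a fresh vertex m for its middle point, in a new bag
-- {m , i , j} hung below a bag holding the current endpoints i and j; an
-- intersection realises both sides between the same endpoints.  Identities
-- are the only obstacle, since they force their endpoints to be one vertex;
-- whether a witness does so can be read off from it in advance.
-- Homomorphisms preserve the semantics of terms, so s holds between the two
-- vertices, and hence between x and y.

open import Defs
open import Function.Base using (_∘_; id)
open import Function.Bundles using (_⇔_; mk⇔; Equivalence)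
open import Data.Bool using (Bool; true; false; T; _∧_; _∨_)
open import Data.Bool.Properties using (T-∧; T-∨)
open import Data.Nat using (ℕ; zero; suc; _≤_; _<_; z≤n; s≤s; _≟_; _<?_)
open import Data.Nat.Properties using (≤-refl; ≤-trans; ≤-reflexive; <⇒≤; <⇒≢; ≤∧≢⇒<; n≤1+n; m≤n⇒m≤1+n)
open import Data.Fin as Fin using (Fin; toℕ; fromℕ<) renaming (zero to fzero; suc to fsuc)
open import Data.Fin.Properties using (toℕ-fromℕ<; fromℕ<-toℕ; toℕ<n)
open import Data.Fin.Induction using (<-wellFounded)
open import Data.List using (List; []; _∷_; length; map)
open import Data.List.Properties using (length-map)
open import Data.List.Membership.Propositional using (_∈_)
open import Data.List.Membership.Propositional.Properties using (∈-map⁺; ∈-map⁻)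
open import Data.List.Relation.Binary.Subset.Propositional using (_⊆_)
open import Data.List.Relation.Unary.Any using (here; there)
open import Data.Product using (∃; ∃₂; _×_; _,_; proj₁; map₁; map₂)
open import Data.Sum using (_⊎_; inj₁; inj₂; [_,_]′)
open import Data.Empty using (⊥-elim)
open import Data.Unit using (tt)
open import Induction.WellFounded using (Acc; acc)
open import Relation.Nullary using (yes; no; contradiction)
open import Relation.Nullary.Decidable using (T?)
open import Relation.Binary.PropositionalEquality using (_≡_; refl; sym; trans; cong; subst; subst₂)
open import Relation.Binary.Construct.Closure.ReflexiveTransitive using (Star; ε; _◅_; _◅◅_; gmap; reverse)

⟦⟧-hom : {A : Set} {S U : Structure A} (f : Carrier S → Carrier U) →
         (∀ {a x y} → rel S a x y → rel U a (f x) (f y)) →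
         ∀ t {x y} → ⟦ t ⟧ S x y → ⟦ t ⟧ U (f x) (f y)
⟦⟧-hom f hom (var a)  r              = hom r
⟦⟧-hom f hom 𝟏        x≡y            = cong f x≡y
⟦⟧-hom f hom 𝟎        ()
⟦⟧-hom f hom ⊤ₜ       _              = tt
⟦⟧-hom f hom (t ⨾ u)  (z , r , r′)   = f z , ⟦⟧-hom f hom t r , ⟦⟧-hom f hom u r′
⟦⟧-hom f hom (t ∪ u)  (inj₁ r)       = inj₁ (⟦⟧-hom f hom t r)
⟦⟧-hom f hom (t ∪ u)  (inj₂ r)       = inj₂ (⟦⟧-hom f hom u r)
⟦⟧-hom f hom (t ∩ u)  (r , r′)       = ⟦⟧-hom f hom t r , ⟦⟧-hom f hom u r′
⟦⟧-hom f hom (t ˘)    r              = ⟦⟧-hom f hom t r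
⟦⟧-hom f hom (t ⋆)    rs             = gmap f (⟦⟧-hom f hom t) rs

update : {X : Set} → ℕ → X → (ℕ → X) → ℕ → X
update k v f m with m ≟ k
... | yes _ = v
... | no  _ = f m

update-≡ : {X : Set} (k : ℕ) (v : X) (f : ℕ → X) → update k v f k ≡ v
update-≡ k v f with k ≟ k
... | yes _   = refl
... | no  k≢k = contradiction refl k≢k

update-< : {X : Set} {k m : ℕ} (v : X) (f : ℕ → X) → m < k → update k v f m ≡ f m
update-< {k = k} {m} v f m<k with m ≟ k
... | yes m≡k = contradiction m≡k (<⇒≢ m<k)
... | no  _   = refl

-- Vertices are the tree nodes themselves.  Node 0 is the root, with bag {0};
-- the fields at index l describe node suc l, whose parent is parent l and
-- whose bag is {suc l} ∪ mates l.  Only nodes up to size matter.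
bagWith : (ℕ → List ℕ) → ℕ → List ℕ
bagWith mates zero    = zero ∷ []
bagWith mates (suc l) = suc l ∷ mates l

bagWith-cong : ∀ {f g : ℕ → List ℕ} {n b} → (∀ {l} → l < n → f l ≡ g l) → b ≤ n →
               bagWith f b ≡ bagWith g b
bagWith-cong {b = zero}  f≗g _   = refl
bagWith-cong {b = suc l} f≗g l<n = cong (suc l ∷_) (f≗g l<n)

record Decomposition (C : Set) : Set where
  field
    size         : ℕ
    label        : ℕ → C
    parent       : ℕ → ℕ
    mates        : ℕ → List ℕ
    parent≤      : ∀ l → parent l ≤ l
    mates≤       : ∀ l {p} → p ∈ mates l → p ≤ l
    mates-length : ∀ l → length (mates l) ≤ 2
    mates⊆parent : ∀ {l} → l < size → mates l ⊆ bagWith mates (parent l)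

  bag : ℕ → List ℕ
  bag = bagWith mates

open Decomposition

module _ {C : Set} where

  ∈-bag⇒≤ : (D : Decomposition C) → ∀ {p b} → p ∈ bag D b → p ≤ b
  ∈-bag⇒≤ D {b = zero}  (here refl) = z≤n
  ∈-bag⇒≤ D {b = suc l} (here refl) = ≤-refl
  ∈-bag⇒≤ D {b = suc l} (there p∈)  = m≤n⇒m≤1+n (mates≤ D l p∈)

  bag-length : (D : Decomposition C) → ∀ b → length (bag D b) ≤ 3
  bag-length D zero    = s≤s z≤n
  bag-length D (suc l) = s≤s (mates-length D l)

  record SharedBag (D : Decomposition C) (p q : ℕ) : Set where
    constructor sharedAt
    field
      node  : ℕ
      node≤ : node ≤ size D
      ∈ˡ    : p ∈ bag D node
      ∈ʳ    : q ∈ bag D node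

  open SharedBag public

  shared⇒≤ˡ : ∀ {D p q} → SharedBag D p q → p ≤ size D
  shared⇒≤ˡ {D} sh = ≤-trans (∈-bag⇒≤ D (∈ˡ sh)) (node≤ sh)

  shared⇒≤ʳ : ∀ {D p q} → SharedBag D p q → q ≤ size D
  shared⇒≤ʳ {D} sh = ≤-trans (∈-bag⇒≤ D (∈ʳ sh)) (node≤ sh)

  record _⊑_ (D D′ : Decomposition C) : Set where
    field
      size≤        : size D ≤ size D′
      label-stable : ∀ {m} → m ≤ size D → label D′ m ≡ label D m
      mates-stable : ∀ {l} → l < size D → mates D′ l ≡ mates D l

  open _⊑_ public

  ⊑-refl : ∀ {D} → D ⊑ D
  ⊑-refl = record { size≤ = ≤-refl ; label-stable = λ _ → refl ; mates-stable = λ _ → refl }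

  ⊑-trans : ∀ {D₁ D₂ D₃} → D₁ ⊑ D₂ → D₂ ⊑ D₃ → D₁ ⊑ D₃
  ⊑-trans D₁⊑D₂ D₂⊑D₃ = record
    { size≤        = ≤-trans (size≤ D₁⊑D₂) (size≤ D₂⊑D₃)
    ; label-stable = λ m≤ →
        trans (label-stable D₂⊑D₃ (≤-trans m≤ (size≤ D₁⊑D₂))) (label-stable D₁⊑D₂ m≤)
    ; mates-stable = λ l< →
        trans (mates-stable D₂⊑D₃ (≤-trans l< (size≤ D₁⊑D₂))) (mates-stable D₁⊑D₂ l<)
    }

  shared-mono : ∀ {D D′ p q} → D ⊑ D′ → SharedBag D p q → SharedBag D′ p q
  shared-mono {D} {D′} {p} {q} D⊑D′ (sharedAt b b≤ p∈ q∈) =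
    sharedAt b (≤-trans b≤ (size≤ D⊑D′)) (subst (p ∈_) (sym bag≡) p∈)
                                         (subst (q ∈_) (sym bag≡) q∈)
    where
    bag≡ : bag D′ b ≡ bag D b
    bag≡ = bagWith-cong (mates-stable D⊑D′) b≤

  record Placed (D : Decomposition C) (i j : ℕ) (x y : C) : Set where
    field
      shared : SharedBag D i j
      labelˡ : label D i ≡ x
      labelʳ : label D j ≡ y

  open Placed public

  placed-mono : ∀ {D D′ i j x y} → D ⊑ D′ → Placed D i j x y → Placed D′ i j x y
  placed-mono D⊑D′ p = record
    { shared = shared-mono D⊑D′ (shared p)
    ; labelˡ = trans (label-stable D⊑D′ (shared⇒≤ˡ (shared p))) (labelˡ p)
    ; labelʳ = trans (label-stable D⊑D′ (shared⇒≤ʳ (shared p))) (labelʳ p)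
    }

  placed-swap : ∀ {D i j x y} → Placed D i j x y → Placed D j i y x
  placed-swap p = record
    { shared = let sharedAt b b≤ i∈ j∈ = shared p in sharedAt b b≤ j∈ i∈
    ; labelˡ = labelʳ p
    ; labelʳ = labelˡ p
    }

  placed-diagˡ : ∀ {D i j x y} → Placed D i j x y → Placed D i i x x
  placed-diagˡ p = record
    { shared = let sharedAt b b≤ i∈ _ = shared p in sharedAt b b≤ i∈ i∈
    ; labelˡ = labelˡ p
    ; labelʳ = labelˡ p
    }

  placed-diagʳ : ∀ {D i j x y} → Placed D i j x y → Placed D j j y y
  placed-diagʳ = placed-diagˡ ∘ placed-swap

  module _ (D : Decomposition C) (z : C) {i j : ℕ} (sh : SharedBag D i j) where

    private
      n : ℕ
      n = size D

      open SharedBag sh renaming (node to β; node≤ to β≤n; ∈ˡ to i∈β; ∈ʳ to j∈β)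

      mates′ : ℕ → List ℕ
      mates′ = update n (i ∷ j ∷ []) (mates D)

      bag′-old : ∀ {b} → b ≤ n → bagWith mates′ b ≡ bag D b
      bag′-old = bagWith-cong (update-< _ (mates D))

      parent≤′ : ∀ l → update n β (parent D) l ≤ l
      parent≤′ l with l ≟ n
      ... | yes refl = β≤n
      ... | no  _    = parent≤ D l

      mates≤′ : ∀ l {p} → p ∈ mates′ l → p ≤ l
      mates≤′ l p∈ with l ≟ n
      mates≤′ l (here refl)         | yes refl = ≤-trans (∈-bag⇒≤ D i∈β) β≤n
      mates≤′ l (there (here refl)) | yes refl = ≤-trans (∈-bag⇒≤ D j∈β) β≤n
      mates≤′ l p∈                  | no  _    = mates≤ D l p∈

      mates-length′ : ∀ l → length (mates′ l) ≤ 2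
      mates-length′ l with l ≟ n
      ... | yes _ = ≤-refl
      ... | no  _ = mates-length D l

      mates⊆parent′ : ∀ {l} → l < suc n → mates′ l ⊆ bagWith mates′ (update n β (parent D) l)
      mates⊆parent′ {l} l<1+n p∈ with l ≟ n
      mates⊆parent′ _ (here refl)         | yes refl = subst (_ ∈_) (sym (bag′-old β≤n)) i∈β
      mates⊆parent′ _ (there (here refl)) | yes refl = subst (_ ∈_) (sym (bag′-old β≤n)) j∈β
      mates⊆parent′ {l} (s≤s l≤n) p∈    | no  l≢n  =
        let l<n = ≤∧≢⇒< l≤n l≢n in
        subst (_ ∈_) (sym (bag′-old (≤-trans (parent≤ D l) (<⇒≤ l<n)))) (mates⊆parent D l<n p∈)

    addLeaf : Decomposition C
    addLeaf = record
      { size         = suc n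
      ; label        = update (suc n) z (label D)
      ; parent       = update n β (parent D)
      ; mates        = mates′
      ; parent≤      = parent≤′
      ; mates≤       = mates≤′
      ; mates-length = mates-length′
      ; mates⊆parent = mates⊆parent′
      }

    ⊑-addLeaf : D ⊑ addLeaf
    ⊑-addLeaf = record
      { size≤        = n≤1+n n
      ; label-stable = λ m≤n → update-< z (label D) (s≤s m≤n)
      ; mates-stable = update-< _ (mates D)
      }

    private
      leaf-bag : bag addLeaf (suc n) ≡ suc n ∷ i ∷ j ∷ []
      leaf-bag = cong (suc n ∷_) (update-≡ n _ (mates D))

      leaf-label : label addLeaf (suc n) ≡ z
      leaf-label = update-≡ (suc n) z (label D)

    addLeaf-placedˡ : ∀ {x y} → Placed D i j x y → Placed addLeaf i (suc n) x z
    addLeaf-placedˡ p = record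
      { shared = sharedAt (suc n) ≤-refl (subst (i ∈_) (sym leaf-bag) (there (here refl)))
                                         (here refl)
      ; labelˡ = labelˡ (placed-mono ⊑-addLeaf p)
      ; labelʳ = leaf-label
      }

    addLeaf-placedʳ : ∀ {x y} → Placed D i j x y → Placed addLeaf (suc n) j z y
    addLeaf-placedʳ p = record
      { shared = sharedAt (suc n) ≤-refl (here refl)
                                         (subst (j ∈_) (sym leaf-bag) (there (there (here refl))))
      ; labelˡ = leaf-label
      ; labelʳ = labelʳ (placed-mono ⊑-addLeaf p)
      }

  root : C → Decomposition C
  root x = record
    { size         = 0
    ; label        = λ _ → x
    ; parent       = λ _ → 0
    ; mates        = λ _ → []
    ; parent≤      = λ _ → z≤n
    ; mates≤       = λ _ ()
    ; mates-length = λ _ → z≤n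
    ; mates⊆parent = λ ()
    }

  root-placed : ∀ {x} → Placed (root x) 0 0 x x
  root-placed = record
    { shared = sharedAt 0 z≤n (here refl) (here refl)
    ; labelˡ = refl
    ; labelʳ = refl
    }

  placeEndpoints : ∀ x y b → (T b → x ≡ y) →
                   ∃₂ λ D i → ∃ λ j → Placed D i j x y × (T b → i ≡ j)
  placeEndpoints x y b x≡y with T? b
  ... | yes b-holds =
    root x , 0 , 0 , subst (Placed (root x) 0 0 x) (x≡y b-holds) root-placed , λ _ → refl
  ... | no  b-fails =
    addLeaf (root x) y (shared root-placed) , 0 , 1 ,
    addLeaf-placedˡ (root x) y (shared root-placed) root-placed , ⊥-elim ∘ b-fails

module _ {A : Set} (S : Structure A) where

  private
    C : Set
    C = Carrier S

  structure : Decomposition C → Structure A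
  structure D = record
    { Carrier = ℕ
    ; point   = 0
    ; rel     = λ a p q → rel S a (label D p) (label D q) × SharedBag D p q
    }

  structure-mono : ∀ {D D′} → D ⊑ D′ →
                   ∀ t {p q} → ⟦ t ⟧ (structure D) p q → ⟦ t ⟧ (structure D′) p q
  structure-mono {D} {D′} D⊑D′ = ⟦⟧-hom id preserve
    where
    preserve : ∀ {a p q} → rel (structure D) a p q → rel (structure D′) a p q
    preserve {a} (r , sh) =
      subst₂ (rel S a) (sym (label-stable D⊑D′ (shared⇒≤ˡ sh)))
                       (sym (label-stable D⊑D′ (shared⇒≤ʳ sh))) r ,
      shared-mono D⊑D′ sh

  module Finite (D : Decomposition C) where

    N : ℕ
    N = size D

    -- out-of-range indices, which never occur in a bag, go to the root
    clamp : ℕ → Fin (suc N)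
    clamp m with m <? suc N
    ... | yes m<1+N = fromℕ< m<1+N
    ... | no  _     = fzero

    toℕ-clamp : ∀ {m} → m ≤ N → toℕ (clamp m) ≡ m
    toℕ-clamp {m} m≤N with m <? suc N
    ... | yes m<1+N = toℕ-fromℕ< m<1+N
    ... | no  m≮1+N = contradiction (s≤s m≤N) m≮1+N

    clamp-toℕ : ∀ x → clamp (toℕ x) ≡ x
    clamp-toℕ x with toℕ x <? suc N
    ... | yes x<1+N = fromℕ<-toℕ x x<1+N
    ... | no  x≮1+N = contradiction (toℕ<n x) x≮1+N

    finBag : Fin (suc N) → List (Fin (suc N))
    finBag b = map clamp (bag D (toℕ b))

    finParent : Fin N → Fin (suc N)
    finParent l = clamp (parent D (toℕ l))

    parent≤N : ∀ (l : Fin N) → parent D (toℕ l) ≤ N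
    parent≤N l = ≤-trans (parent≤ D (toℕ l)) (<⇒≤ (toℕ<n l))

    finParent≤ : ∀ l → toℕ (finParent l) ≤ toℕ l
    finParent≤ l = subst (_≤ toℕ l) (sym (toℕ-clamp (parent≤N l))) (parent≤ D (toℕ l))

    ∈-finBag : ∀ {p b} → b ≤ N → p ∈ bag D b → clamp p ∈ finBag (clamp b)
    ∈-finBag {p} b≤N p∈ =
      subst (λ c → clamp p ∈ map clamp (bag D c)) (sym (toℕ-clamp b≤N)) (∈-map⁺ clamp p∈)

    own∈finBag : ∀ x → x ∈ finBag x
    own∈finBag fzero    = here (sym (clamp-toℕ fzero))
    own∈finBag (fsuc l) = here (sym (clamp-toℕ (fsuc l)))

    finBag-step : ∀ {x} b → x ∈ finBag b → x ≡ b ⊎ ∃ λ l → b ≡ fsuc l × x ∈ finBag (finParent l)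
    finBag-step fzero x∈ with ∈-map⁻ clamp {xs = bag D 0} x∈
    ... | _ , here refl , x≡ = inj₁ (trans x≡ (clamp-toℕ fzero))
    finBag-step (fsuc l) x∈ with ∈-map⁻ clamp {xs = bag D (suc (toℕ l))} x∈
    ... | _ , here refl , x≡ = inj₁ (trans x≡ (clamp-toℕ (fsuc l)))
    ... | _ , there p∈ , refl =
      inj₂ (l , refl , ∈-finBag (parent≤N l) (mates⊆parent D (toℕ<n l) p∈))

    -- In this decomposition the vertex x is itself a node, the topmost one whose bag holds x.
    pathToOwnBag : ∀ {x} b → Acc Fin._<_ b → x ∈ finBag b →
                   Star (TreeEdgeAt finParent finBag x) b x
    pathToOwnBag b (acc smaller) x∈ with finBag-step b x∈
    ... | inj₁ refl               = ε
    ... | inj₂ (l , refl , x∈′) =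
      ((l , inj₁ (refl , refl)) , x∈ , x∈′) ◅
      pathToOwnBag (finParent l) (smaller (s≤s (finParent≤ l))) x∈′

    flipEdge : ∀ {x b c} → TreeEdgeAt finParent finBag x b c → TreeEdgeAt finParent finBag x c b
    flipEdge ((l , inj₁ e) , b∈ , c∈) = (l , inj₂ e) , c∈ , b∈
    flipEdge ((l , inj₂ e) , b∈ , c∈) = (l , inj₁ e) , c∈ , b∈

    finRel : A → Fin (suc N) → Fin (suc N) → Set
    finRel a x y = rel S a (label D (toℕ x)) (label D (toℕ y)) × ∃ λ b → x ∈ finBag b × y ∈ finBag b

    finDecomposition : TreeDecompW2 (GraphEdge finRel)
    finDecomposition = record
      { k         = N
      ; parent    = finParent
      ; parent-<  = finParent≤
      ; bag       = finBag
      ; width≤2   = λ b → ≤-trans (≤-reflexive (length-map clamp (bag D (toℕ b)))) (bag-length D (toℕ b))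
      ; vcover    = λ x → x , own∈finBag x
      ; ecover    = λ { x y _ (_ , _ , shared) → shared }
      ; connected = λ x b c x∈b x∈c →
          pathToOwnBag b (<-wellFounded b) x∈b ◅◅
          reverse flipEdge (pathToOwnBag c (<-wellFounded c) x∈c)
      }

    structure⇒fin : ∀ t {p q} → ⟦ t ⟧ (structure D) p q →
                    ⟦ t ⟧ (finStructure N finRel) (clamp p) (clamp q)
    structure⇒fin = ⟦⟧-hom clamp preserve
      where
      preserve : ∀ {a p q} → rel (structure D) a p q → finRel a (clamp p) (clamp q)
      preserve {a} (r , sh@(sharedAt b b≤N p∈ q∈)) =
        subst₂ (rel S a) (sym (cong (label D) (toℕ-clamp (shared⇒≤ˡ sh))))
                         (sym (cong (label D) (toℕ-clamp (shared⇒≤ʳ sh)))) r ,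
        clamp b , ∈-finBag b≤N p∈ , ∈-finBag b≤N q∈

    fin⇒S : ∀ t {x y} → ⟦ t ⟧ (finStructure N finRel) x y →
            ⟦ t ⟧ S (label D (toℕ x)) (label D (toℕ y))
    fin⇒S = ⟦⟧-hom (label D ∘ toℕ) proj₁

  TW2⊨-transfer : ∀ {t s} → TW2⊨ t ≤ s →
                  ∀ D {i j x y} → Placed D i j x y → ⟦ t ⟧ (structure D) i j → ⟦ s ⟧ S x y
  TW2⊨-transfer {t} {s} t≤s D p tᴰ =
    subst₂ (⟦ s ⟧ S) (relabel (shared⇒≤ˡ (shared p)) (labelˡ p))
                     (relabel (shared⇒≤ʳ (shared p)) (labelʳ p))
      (fin⇒S s (t≤s N finRel finDecomposition _ _ (structure⇒fin t tᴰ)))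
    where
    open Finite D
    relabel : ∀ {m x} → m ≤ N → label D m ≡ x → label D (toℕ (clamp m)) ≡ x
    relabel m≤N refl = cong (label D) (toℕ-clamp m≤N)

  -- A witness collapses when it forces its endpoints to be equal by way of 𝟏.
  -- Exactly these must be realised on a single vertex; all others can be
  -- realised between any two vertices carrying the right labels.
  collapses : ∀ t {x y} → ⟦ t ⟧ S x y → Bool
  collapses (var a)  _             = false
  collapses 𝟏        _             = true
  collapses 𝟎        ()
  collapses ⊤ₜ       _             = false
  collapses (t ⨾ u)  (_ , w , w′)  = collapses t w ∧ collapses u w′
  collapses (t ∪ u)  (inj₁ w)      = collapses t w
  collapses (t ∪ u)  (inj₂ w)      = collapses u w
  collapses (t ∩ u)  (w , w′)      = collapses t w ∨ collapses u w′
  collapses (t ˘)    w             = collapses t w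
  collapses (t ⋆)    ε             = true
  collapses (t ⋆)    (w ◅ ws)      = collapses t w ∧ collapses (t ⋆) ws

  collapses⇒≡ : ∀ t {x y} (w : ⟦ t ⟧ S x y) → T (collapses t w) → x ≡ y
  collapses⇒≡ 𝟏       x≡y          _ = x≡y
  collapses⇒≡ (t ⨾ u) (_ , w , w′) c =
    let (c₁ , c₂) = Equivalence.to T-∧ c in trans (collapses⇒≡ t w c₁) (collapses⇒≡ u w′ c₂)
  collapses⇒≡ (t ∪ u) (inj₁ w)     c = collapses⇒≡ t w c
  collapses⇒≡ (t ∪ u) (inj₂ w)     c = collapses⇒≡ u w c
  collapses⇒≡ (t ∩ u) (w , w′)     c = [ collapses⇒≡ t w , collapses⇒≡ u w′ ]′ (Equivalence.to T-∨ c)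
  collapses⇒≡ (t ˘)   w            c = sym (collapses⇒≡ t w c)
  collapses⇒≡ (t ⋆)   ε            _ = refl
  collapses⇒≡ (t ⋆)   (w ◅ ws)     c =
    let (c₁ , c₂) = Equivalence.to T-∧ c in trans (collapses⇒≡ t w c₁) (collapses⇒≡ (t ⋆) ws c₂)

  Realisable : ∀ t {x y} → ⟦ t ⟧ S x y → Set
  Realisable t {x} {y} w =
    ∀ D i j → Placed D i j x y → (T (collapses t w) → i ≡ j) →
    ∃ λ D′ → D ⊑ D′ × ⟦ t ⟧ (structure D′) i j

  module _ {t u x z y} {w : ⟦ t ⟧ S x z} {w′ : ⟦ u ⟧ S z y}
           (realise-t : Realisable t w) (realise-u : Realisable u w′) where

    realise-⨾-via : ∀ D i m j → Placed D i m x z → Placed D m j z y →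
                    (T (collapses t w) → i ≡ m) → (T (collapses u w′) → m ≡ j) →
                    ∃ λ D′ → D ⊑ D′ × ⟦ t ⨾ u ⟧ (structure D′) i j
    realise-⨾-via D i m j p q i≡m m≡j =
      let (D₁ , D⊑D₁ , tᴰ) = realise-t D i m p i≡m
          (D₂ , D₁⊑D₂ , uᴰ) = realise-u D₁ m j (placed-mono D⊑D₁ q) m≡j
      in D₂ , ⊑-trans D⊑D₁ D₁⊑D₂ , m , structure-mono D₁⊑D₂ t tᴰ , uᴰ

    -- The middle point is an endpoint if one factor collapses, a fresh leaf otherwise.
    realise-⨾ : Realisable (t ⨾ u) (z , w , w′)
    realise-⨾ D i j p i≡j with T? (collapses t w) | T? (collapses u w′)
    ... | yes c | _ =
      let x≡z = collapses⇒≡ t w c in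
      realise-⨾-via D i i j
        (subst (Placed D i i x) x≡z (placed-diagˡ p)) (subst (λ v → Placed D i j v y) x≡z p)
        (λ _ → refl) (λ c′ → i≡j (Equivalence.from T-∧ (c , c′)))
    ... | no ¬c | yes c′ =
      let y≡z = sym (collapses⇒≡ u w′ c′) in
      realise-⨾-via D i j j
        (subst (Placed D i j x) y≡z p) (subst (λ v → Placed D j j v y) y≡z (placed-diagʳ p))
        (⊥-elim ∘ ¬c) (λ _ → refl)
    ... | no ¬c | no ¬c′ =
      let sh = shared p in
      map₂ (map₁ (⊑-trans (⊑-addLeaf D z sh)))
        (realise-⨾-via (addLeaf D z sh) i (suc (size D)) j
          (addLeaf-placedˡ D z sh p) (addLeaf-placedʳ D z sh p) (⊥-elim ∘ ¬c) (⊥-elim ∘ ¬c′))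

  realise : ∀ t {x y} (w : ⟦ t ⟧ S x y) → Realisable t w
  realise (var a) r D i j p _ =
    D , ⊑-refl , subst₂ (rel S a) (sym (labelˡ p)) (sym (labelʳ p)) r , shared p
  realise 𝟏 _ D i j _ i≡j = D , ⊑-refl , i≡j tt
  realise 𝟎 ()
  realise ⊤ₜ _ D i j _ _ = D , ⊑-refl , tt
  realise (t ⨾ u) (_ , w , w′) = realise-⨾ {t} {u} {w = w} {w′} (realise t w) (realise u w′)
  realise (t ∪ u) (inj₁ w) D i j p i≡j = map₂ (map₂ inj₁) (realise t w D i j p i≡j)
  realise (t ∪ u) (inj₂ w) D i j p i≡j = map₂ (map₂ inj₂) (realise u w D i j p i≡j)
  realise (t ∩ u) (w , w′) D i j p i≡j =
    let (D₁ , D⊑D₁ , tᴰ) = realise t w D i j p (i≡j ∘ Equivalence.from T-∨ ∘ inj₁)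
        (D₂ , D₁⊑D₂ , uᴰ) = realise u w′ D₁ i j (placed-mono D⊑D₁ p) (i≡j ∘ Equivalence.from T-∨ ∘ inj₂)
    in D₂ , ⊑-trans D⊑D₁ D₁⊑D₂ , structure-mono D₁⊑D₂ t tᴰ , uᴰ
  realise (t ˘) w D i j p i≡j = realise t w D j i (placed-swap p) (sym ∘ i≡j)
  realise (t ⋆) ε D i j _ i≡j = D , ⊑-refl , subst (Star _ i) (i≡j tt) ε
  realise (t ⋆) (w ◅ ws) D i j p i≡j =
    map₂ (map₂ λ (_ , tᴰ , tsᴰ) → tᴰ ◅ tsᴰ)
      (realise-⨾ {t} {t ⋆} {w = w} {ws} (realise t w) (realise (t ⋆) ws) D i j p i≡j)

  TW2⊨⇒⊨ : ∀ {t s} → TW2⊨ t ≤ s → S ⊨ t ≤ s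
  TW2⊨⇒⊨ {t} {s} t≤s x y w =
    let (D , i , j , p , i≡j) = placeEndpoints x y (collapses t w) (collapses⇒≡ t w)
        (D′ , D⊑D′ , tᴰ) = realise t w D i j p i≡j
    in TW2⊨-transfer {t} {s} t≤s D′ (placed-mono D⊑D′ p) tᴰ

proposition2p9 : {A : Set} (t s : Term A) → (REL⊨ t ≤ s) ⇔ (TW2⊨ t ≤ s)
proposition2p9 t s = mk⇔ (λ t≤s n r _ → t≤s (finStructure n r)) (λ t≤s S → TW2⊨⇒⊨ S {t} {s} t≤s)
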